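{- Let $X$ be a uniform multi-set. For any integers $v\ge1$ and $1\le h\le(v-1)/4$, every number in the iterated sumset $\mathcal{B}_{v,X}^h$ can be represented as a sum of $2h$ distinct elements of $X$.
   Context: $X$ is a finite non-empty multi-set of positive integers; $\mu_X$ denotes its largest multiplicity and $\mathrm{supp}(X)$ the set of distinct integers in $X$. $X$ is uniform if every $x\in X$ has multiplicity exactly $\mu_X$. For a uniform $X$ and integer $z$, $f_X(z) := \mu_X\cdot|\{(x,x')\in\mathrm{supp}(X)\times\mathrm{supp}(X)\mid x+x'=z\}|$. For an integer $v\ge1$, the bucket is $\mathcal{B}_{v,X} := \{z\in\mathbb{N}\mid f_X(z)\ge v\}$. For a set $B$, $B^h$ denotes the set of all sums of $h$ (not necessarily distinct) elements of $B$. "Distinct elements of $X$" means any integer $x$ may be used up to its multiplicity in $X$ times. -}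

module Defs where

open import Data.Nat using (ℕ; _+_; _*_; _≤_; _<_; _⊔_; _≟_)
open import Data.List using (List; []; _∷_; length; filter; map; foldr; deduplicate; cartesianProduct)
open import Data.List.Relation.Unary.All using (All)
open import Data.Nat.ListAction using (sum)
open import Data.Product using (_×_; _,_; ∃-syntax)
open import Relation.Binary.PropositionalEquality using (_≡_)

-- A finite multiset of naturals, represented by a list (order irrelevant).
Multiset : Set
Multiset = List ℕ

count : ℕ → Multiset → ℕ
count x X = length (filter (x ≟_) X)

μ : Multiset → ℕ
μ X = foldr _⊔_ 0 (map (λ x → count x X) X)

supp : Multiset → List ℕ
supp X = deduplicate _≟_ X

IsPosMultiset : Multiset → Set
IsPosMultiset X = (0 < length X) × All (λ x → 0 < x) X

Uniform : Multiset → Set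
Uniform X = All (λ x → count x X ≡ μ X) X

f : Multiset → ℕ → ℕ
f X z = μ X * length (filter (λ p → (Data.Product.proj₁ p + Data.Product.proj₂ p) ≟ z)
                                 (cartesianProduct (supp X) (supp X)))

InBucket : ℕ → Multiset → ℕ → Set
InBucket v X z = v ≤ f X z

InSumset : (ℕ → Set) → ℕ → ℕ → Set
InSumset B h z = ∃[ zs ] (length zs ≡ h × All B zs × sum zs ≡ z)

SubMultiset : Multiset → Multiset → Set
SubMultiset Y X = ∀ y → count y Y ≤ count y X

-- z is a sum of k distinct elements of X (in the multiset sense)
SumOfDistinct : Multiset → ℕ → ℕ → Set
SumOfDistinct X k z = ∃[ Y ] (length Y ≡ k × SubMultiset Y X × sum Y ≡ z)

-- Process the h bucket elements z₁, …, z_h one at a time, choosing for each a pair (a , b) in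
-- supp X with a + b = zᵢ whose addition keeps the chosen elements a sub-multiset of X. After k
-- steps 2k elements are used. A pair is blocked only if a or b already occurs μ_X times among
-- the used elements together with the pair itself, which gives μ_X ≤ #a + #b + [a = b]. Since a
-- determines b and b determines a, summing over the f_X(zᵢ)/μ_X pairs yields f_X(zᵢ) ≤ 4k + 1,
-- so the bound v ≥ 4h + 1 ≥ 4k + 2 leaves a free pair at every step.
module Submission where

open import Defs

open import Data.Nat using (ℕ; suc; _+_; _*_; _≤_; _≟_; _≤?_; z≤n; s≤s)
open import Data.Empty using (⊥-elim)
open import Data.List using (List; []; _∷_; [_]; _++_; length; filter; cartesianProduct)
open import Data.List.Properties using (length-++; filter-++; ++-identityʳ; filter-accept; filter-reject)
open import Data.List.Membership.Propositional using (_∈_; find)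
open import Data.List.Membership.Propositional.Properties using (∈-filter⁻; ∈-cartesianProduct⁻; ∈-deduplicate⁻)
open import Data.List.Relation.Binary.Permutation.Propositional using (_↭_)
open import Data.List.Relation.Binary.Permutation.Propositional.Properties using (↭-length; filter-↭; shifts)
open import Data.List.Relation.Unary.All using (All; []; _∷_; lookup)
open import Data.List.Relation.Unary.All.Properties using (¬Any⇒All¬)
open import Data.List.Relation.Unary.Any using (here; there; any?)
open import Data.List.Relation.Unary.Unique.Propositional using (Unique; _∷_)
open import Data.List.Relation.Unary.Unique.Propositional.Properties using (filter⁺; cartesianProduct⁺)
open import Data.List.Relation.Unary.Unique.DecPropositional.Properties _≟_ using (deduplicate-!)
open import Data.Nat.ListAction using (sum)
open import Data.Nat.Properties
open import Algebra.Properties.CommutativeSemigroup +-commutativeSemigroup using (interchange)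
open import Data.Nat.Tactic.RingSolver using (solve-∀)
open import Data.Product using (_×_; _,_; proj₁; proj₂; ∃-syntax)
open import Function using (_∘_)
open import Relation.Nullary using (¬_; yes; no; _×-dec_)
open import Relation.Unary using (Decidable)
open import Relation.Binary.PropositionalEquality using (_≡_; _≢_; refl; sym; trans; cong; cong₂; subst; module ≡-Reasoning)

δ : ℕ → ℕ → ℕ
δ x y = count x [ y ]

δ-≡ : ∀ {x y} → x ≡ y → δ x y ≡ 1
δ-≡ {x} {y} x≡y rewrite filter-accept (x ≟_) {y} {[]} x≡y = refl

δ-refl : ∀ x → δ x x ≡ 1
δ-refl x = δ-≡ {x} refl

δ-≢ : ∀ {x y} → x ≢ y → δ x y ≡ 0
δ-≢ {x} {y} x≢y rewrite filter-reject (x ≟_) {y} {[]} x≢y = refl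

δ-≤1 : ∀ x y → δ x y ≤ 1
δ-≤1 x y with x ≟ y
... | yes x≡y = ≤-reflexive (δ-≡ x≡y)
... | no x≢y = ≤-trans (≤-reflexive (δ-≢ x≢y)) z≤n

δ-pos⇒≡ : ∀ {x y} → 1 ≤ δ x y → x ≡ y
δ-pos⇒≡ {x} {y} δ-pos with x ≟ y
... | yes x≡y = x≡y
... | no x≢y = ⊥-elim (1+n≰n (subst (1 ≤_) (δ-≢ x≢y) δ-pos))

δ-sym : ∀ x y → δ x y ≡ δ y x
δ-sym x y with x ≟ y
... | yes x≡y = trans (δ-≡ x≡y) (sym (δ-≡ (sym x≡y)))
... | no x≢y = trans (δ-≢ x≢y) (sym (δ-≢ (x≢y ∘ sym)))

count-++ : ∀ x A B → count x (A ++ B) ≡ count x A + count x B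
count-++ x A B rewrite filter-++ (x ≟_) A B = length-++ (filter (x ≟_) A)

count-∷ : ∀ x y L → count x (y ∷ L) ≡ δ x y + count x L
count-∷ x y = count-++ x [ y ]

count-↭ : ∀ x {A B} → A ↭ B → count x A ≡ count x B
count-↭ x A↭B = ↭-length (filter-↭ (x ≟_) A↭B)

∑ : {A : Set} → List A → (A → ℕ) → ℕ
∑ [] g = 0
∑ (x ∷ L) g = g x + ∑ L g

syntax ∑ L (λ p → e) = ∑[ p ∈ L ] e

module _ {A : Set} where

  ∑-cong : ∀ (L : List A) {g h} → (∀ x → g x ≡ h x) → ∑ L g ≡ ∑ L h
  ∑-cong [] g≡h = refl
  ∑-cong (x ∷ L) g≡h = cong₂ _+_ (g≡h x) (∑-cong L g≡h)

  ∑-mono-≤ : ∀ (L : List A) {g h} → (∀ {x} → x ∈ L → g x ≤ h x) → ∑ L g ≤ ∑ L h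
  ∑-mono-≤ [] g≤h = z≤n
  ∑-mono-≤ (x ∷ L) g≤h = +-mono-≤ (g≤h (here refl)) (∑-mono-≤ L (g≤h ∘ there))

  ∑-distrib-+ : ∀ (L : List A) g h → ∑[ x ∈ L ] (g x + h x) ≡ ∑ L g + ∑ L h
  ∑-distrib-+ [] g h = refl
  ∑-distrib-+ (x ∷ L) g h = begin
    g x + h x + ∑[ y ∈ L ] (g y + h y) ≡⟨ cong (g x + h x +_) (∑-distrib-+ L g h) ⟩
    g x + h x + (∑ L g + ∑ L h)        ≡⟨ interchange (g x) (h x) (∑ L g) (∑ L h) ⟩
    g x + ∑ L g + (h x + ∑ L h)        ∎
    where open ≡-Reasoning

  ∑-const : ∀ (L : List A) c → ∑[ _ ∈ L ] c ≡ c * length L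
  ∑-const [] c = sym (*-zeroʳ c)
  ∑-const (x ∷ L) c = trans (cong (c +_) (∑-const L c)) (sym (*-suc c (length L)))

  ∑-zero : ∀ (L : List A) {g} → (∀ {x} → x ∈ L → g x ≡ 0) → ∑ L g ≡ 0
  ∑-zero [] g≡0 = refl
  ∑-zero (x ∷ L) g≡0 rewrite g≡0 (here refl) = ∑-zero L (g≡0 ∘ there)

  ∑-indicator-≤1 : ∀ {L : List A} {g} → Unique L → (∀ x → g x ≤ 1) →
                   (∀ {p q} → p ∈ L → q ∈ L → 1 ≤ g p → 1 ≤ g q → p ≡ q) → ∑ L g ≤ 1
  ∑-indicator-≤1 {[]} _ _ _ = z≤n
  ∑-indicator-≤1 {x ∷ L} {g} (x∉L ∷ unique) g≤1 atMostOne with 1 ≤? g x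
  ... | yes gx-pos = subst (_≤ 1) (sym (trans (cong (g x +_) (∑-zero L vanishes)) (+-identityʳ (g x)))) (g≤1 x)
    where
    vanishes : ∀ {q} → q ∈ L → g q ≡ 0
    vanishes {q} q∈L with 1 ≤? g q
    ... | yes gq-pos = ⊥-elim (lookup x∉L q∈L (atMostOne (here refl) (there q∈L) gx-pos gq-pos))
    ... | no gq≱1 = n<1⇒n≡0 (≰⇒> gq≱1)
  ... | no gx≱1 = subst (λ t → t + ∑ L g ≤ 1) (sym (n<1⇒n≡0 (≰⇒> gx≱1)))
                    (∑-indicator-≤1 unique g≤1 (λ p∈L q∈L → atMostOne (there p∈L) (there q∈L)))

  module _ {L : List A} (g : A → ℕ) (unique : Unique L)
           (injective : ∀ {p q} → p ∈ L → q ∈ L → g p ≡ g q → p ≡ q) where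

    ∑-δ-≤1 : ∀ x → ∑[ p ∈ L ] δ (g p) x ≤ 1
    ∑-δ-≤1 x = ∑-indicator-≤1 unique (λ p → δ-≤1 (g p) x)
      (λ p∈L q∈L δp-pos δq-pos → injective p∈L q∈L (trans (δ-pos⇒≡ δp-pos) (sym (δ-pos⇒≡ δq-pos))))

    ∑-count-≤-length : ∀ U → ∑[ p ∈ L ] count (g p) U ≤ length U
    ∑-count-≤-length [] = ≤-reflexive (∑-const L 0)
    ∑-count-≤-length (x ∷ U) = begin
      ∑[ p ∈ L ] count (g p) (x ∷ U)                 ≡⟨ ∑-cong L (λ p → count-∷ (g p) x U) ⟩
      ∑[ p ∈ L ] (δ (g p) x + count (g p) U)         ≡⟨ ∑-distrib-+ L (λ p → δ (g p) x) (λ p → count (g p) U) ⟩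
      ∑[ p ∈ L ] δ (g p) x + ∑[ p ∈ L ] count (g p) U ≤⟨ +-mono-≤ (∑-δ-≤1 x) (∑-count-≤-length U) ⟩
      suc (length U)                                   ∎
      where open ≤-Reasoning

m+m≡n+n⇒m≡n : ∀ m n → m + m ≡ n + n → m ≡ n
m+m≡n+n⇒m≡n m n m+m≡n+n = *-cancelˡ-≡ m n 2 (begin
  m + (m + 0) ≡⟨ cong (m +_) (+-identityʳ m) ⟩
  m + m       ≡⟨ m+m≡n+n ⟩
  n + n       ≡⟨ cong (n +_) (+-identityʳ n) ⟨
  n + (n + 0) ∎)
  where open ≡-Reasoning

sumPairs : Multiset → ℕ → List (ℕ × ℕ)
sumPairs X z = filter (λ p → (proj₁ p + proj₂ p) ≟ z) (cartesianProduct (supp X) (supp X))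

module _ (X : Multiset) (z : ℕ) where

  sumPairs-unique : Unique (sumPairs X z)
  sumPairs-unique = filter⁺ (λ p → (proj₁ p + proj₂ p) ≟ z) (cartesianProduct⁺ (deduplicate-! X) (deduplicate-! X))

  ∈-sumPairs⁻ : ∀ {a b} → (a , b) ∈ sumPairs X z → (a ∈ supp X × b ∈ supp X) × a + b ≡ z
  ∈-sumPairs⁻ p∈ with ∈-filter⁻ (λ p → (proj₁ p + proj₂ p) ≟ z) p∈
  ... | p∈product , sums-to-z = ∈-cartesianProduct⁻ (supp X) (supp X) p∈product , sums-to-z

  private
    same-sum : ∀ {a b a' b'} → (a , b) ∈ sumPairs X z → (a' , b') ∈ sumPairs X z → a + b ≡ a' + b'
    same-sum p∈ q∈ = trans (proj₂ (∈-sumPairs⁻ p∈)) (sym (proj₂ (∈-sumPairs⁻ q∈)))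

  sumPairs-proj₁-injective : ∀ {p q} → p ∈ sumPairs X z → q ∈ sumPairs X z → proj₁ p ≡ proj₁ q → p ≡ q
  sumPairs-proj₁-injective {a , b} p∈ q∈ refl = cong (a ,_) (+-cancelˡ-≡ a b _ (same-sum p∈ q∈))

  sumPairs-proj₂-injective : ∀ {p q} → p ∈ sumPairs X z → q ∈ sumPairs X z → proj₂ p ≡ proj₂ q → p ≡ q
  sumPairs-proj₂-injective {a , b} p∈ q∈ refl = cong (_, b) (+-cancelʳ-≡ b a _ (same-sum p∈ q∈))

  sumPairs-diagonal-≤1 : ∑[ p ∈ sumPairs X z ] δ (proj₁ p) (proj₂ p) ≤ 1
  sumPairs-diagonal-≤1 = ∑-indicator-≤1 sumPairs-unique (λ p → δ-≤1 (proj₁ p) (proj₂ p)) diagonal-unique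
    where
    diagonal-unique : ∀ {p q} → p ∈ sumPairs X z → q ∈ sumPairs X z →
                      1 ≤ δ (proj₁ p) (proj₂ p) → 1 ≤ δ (proj₁ q) (proj₂ q) → p ≡ q
    diagonal-unique {a , b} {a' , b'} p∈ q∈ δp-pos δq-pos
      with refl ← δ-pos⇒≡ {a} {b} δp-pos | refl ← δ-pos⇒≡ {a'} {b'} δq-pos
      with refl ← m+m≡n+n⇒m≡n a a' (same-sum p∈ q∈) = refl

Fits : Multiset → Multiset → ℕ × ℕ → Set
Fits X U (a , b) = count a (a ∷ b ∷ U) ≤ count a X × count b (a ∷ b ∷ U) ≤ count b X

fits? : ∀ X U → Decidable (Fits X U)
fits? X U (a , b) = (count a (a ∷ b ∷ U) ≤? count a X) ×-dec (count b (a ∷ b ∷ U) ≤? count b X)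

count-∷-∷ˡ : ∀ a b U → count a (a ∷ b ∷ U) ≡ suc (δ a b + count a U)
count-∷-∷ˡ a b U = begin
  count a (a ∷ b ∷ U)         ≡⟨ count-∷ a a (b ∷ U) ⟩
  δ a a + count a (b ∷ U)     ≡⟨ cong₂ _+_ (δ-refl a) (count-∷ a b U) ⟩
  suc (δ a b + count a U)     ∎
  where open ≡-Reasoning

count-∷-∷ʳ : ∀ a b U → count b (a ∷ b ∷ U) ≡ suc (δ a b + count b U)
count-∷-∷ʳ a b U = begin
  count b (a ∷ b ∷ U)         ≡⟨ count-∷ b a (b ∷ U) ⟩
  δ b a + count b (b ∷ U)     ≡⟨ cong₂ _+_ (δ-sym b a) (count-∷ b b U) ⟩
  δ a b + (δ b b + count b U) ≡⟨ cong (λ t → δ a b + (t + count b U)) (δ-refl b) ⟩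
  δ a b + suc (count b U)     ≡⟨ +-suc (δ a b) (count b U) ⟩
  suc (δ a b + count b U)     ∎
  where open ≡-Reasoning

¬Fits-bound : ∀ X U a b {n} → count a X ≡ n → count b X ≡ n → ¬ Fits X U (a , b) →
              n ≤ count a U + count b U + δ a b
¬Fits-bound X U a b {n} #a≡n #b≡n ¬fits with n ≤? count a U + count b U + δ a b
... | yes bounded = bounded
... | no unbounded = ⊥-elim (¬fits ( fits-below #a≡n (count-∷-∷ˡ a b U) (m≤m+n _ _)
                                  , fits-below #b≡n (count-∷-∷ʳ a b U) (m≤n+m _ _)))
  where
  fits-below : ∀ {c m u} → c ≡ n → m ≡ suc (δ a b + u) → u ≤ count a U + count b U → m ≤ c
  fits-below refl refl u≤ =
    ≤-trans (s≤s (≤-trans (≤-reflexive (+-comm (δ a b) _)) (+-monoˡ-≤ (δ a b) u≤))) (≰⇒> unbounded)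

module _ {X : Multiset} (uniform : Uniform X) (U : Multiset) (z : ℕ) where

  private
    count-supp : ∀ {a} → a ∈ supp X → count a X ≡ μ X
    count-supp a∈ = lookup uniform (∈-deduplicate⁻ _≟_ X a∈)

    P = sumPairs X z

  unfit-bound : All (¬_ ∘ Fits X U) P → f X z ≤ length U + length U + 1
  unfit-bound all-unfit = begin
    μ X * length P                                                          ≡⟨ sym (∑-const P (μ X)) ⟩
    ∑[ _ ∈ P ] μ X                                                          ≤⟨ ∑-mono-≤ P blocked ⟩
    ∑[ p ∈ P ] (count (proj₁ p) U + count (proj₂ p) U + δ (proj₁ p) (proj₂ p))
      ≡⟨ ∑-distrib-+ P (λ p → count (proj₁ p) U + count (proj₂ p) U) (λ p → δ (proj₁ p) (proj₂ p)) ⟩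
    ∑[ p ∈ P ] (count (proj₁ p) U + count (proj₂ p) U) + ∑[ p ∈ P ] δ (proj₁ p) (proj₂ p)
      ≡⟨ cong (_+ ∑[ p ∈ P ] δ (proj₁ p) (proj₂ p)) (∑-distrib-+ P (λ p → count (proj₁ p) U) (λ p → count (proj₂ p) U)) ⟩
    ∑[ p ∈ P ] count (proj₁ p) U + ∑[ p ∈ P ] count (proj₂ p) U + ∑[ p ∈ P ] δ (proj₁ p) (proj₂ p)
      ≤⟨ +-mono-≤ (+-mono-≤ (∑-count-≤-length proj₁ (sumPairs-unique X z) (sumPairs-proj₁-injective X z) U)
                            (∑-count-≤-length proj₂ (sumPairs-unique X z) (sumPairs-proj₂-injective X z) U))
                  (sumPairs-diagonal-≤1 X z) ⟩
    length U + length U + 1                                                 ∎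
    where
    open ≤-Reasoning
    blocked : ∀ {p} → p ∈ P → μ X ≤ count (proj₁ p) U + count (proj₂ p) U + δ (proj₁ p) (proj₂ p)
    blocked {a , b} p∈ with (a∈ , b∈) , _ ← ∈-sumPairs⁻ X z p∈ =
      ¬Fits-bound X U a b (count-supp a∈) (count-supp b∈) (lookup all-unfit p∈)

  fitting-pair : ∀ {v} → v ≤ f X z → length U + length U + 2 ≤ v → ∃[ p ] (p ∈ P × Fits X U p)
  fitting-pair {v} v≤f room with any? (fits? X U) P
  ... | yes some-fit = find some-fit
  ... | no none-fit = ⊥-elim (<-irrefl refl (begin-strict
    f X z                   ≤⟨ unfit-bound (¬Any⇒All¬ P none-fit) ⟩
    length U + length U + 1 <⟨ ≤-reflexive (sym (+-suc (length U + length U) 1)) ⟩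
    length U + length U + 2 ≤⟨ room ⟩
    v                       ≤⟨ v≤f ⟩
    f X z                   ∎))
    where open ≤-Reasoning

SubMultiset-∷ : ∀ X U a → SubMultiset U X → count a (a ∷ U) ≤ count a X → SubMultiset (a ∷ U) X
SubMultiset-∷ X U a U⊆X a-fits y with y ≟ a
... | yes refl = a-fits
... | no y≢a = subst (_≤ count y X) (sym (trans (count-∷ y a U) (cong (_+ count y U) (δ-≢ y≢a)))) (U⊆X y)

SubMultiset-fits : ∀ X U a b → SubMultiset U X → Fits X U (a , b) → SubMultiset (a ∷ b ∷ U) X
SubMultiset-fits X U a b U⊆X (a-fits , b-fits) =
  SubMultiset-∷ X (b ∷ U) a (SubMultiset-∷ X U b U⊆X (≤-trans b-not-after-a b-fits)) a-fits
  where
  b-not-after-a : count b (b ∷ U) ≤ count b (a ∷ b ∷ U)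
  b-not-after-a = subst (count b (b ∷ U) ≤_) (sym (count-∷ b a (b ∷ U))) (m≤n+m _ _)

SubMultiset-↭ : ∀ X {A B} → A ↭ B → SubMultiset A X → SubMultiset B X
SubMultiset-↭ X A↭B A⊆X y = subst (_≤ count y X) (count-↭ y A↭B) (A⊆X y)

budget-covers-step : ∀ u k → u + u + 2 ≤ u + u + 4 * suc k + 1
budget-covers-step u k = ≤-trans (m≤m+n _ (4 * k + 3)) (≤-reflexive (regroup u k))
  where
  regroup : ∀ u k → u + u + 2 + (4 * k + 3) ≡ u + u + 4 * suc k + 1
  regroup = solve-∀

budget-after-step : ∀ u k → u + u + 4 * suc k + 1 ≡ suc (suc u) + suc (suc u) + 4 * k + 1
budget-after-step = solve-∀

greedy-distinct : ∀ {X} → Uniform X → ∀ {v} zs U → All (InBucket v X) zs →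
                  length U + length U + 4 * length zs + 1 ≤ v → SubMultiset U X →
                  ∃[ Y ] (length Y ≡ 2 * length zs × SubMultiset (Y ++ U) X × sum Y ≡ sum zs)
greedy-distinct uniform [] U [] _ U⊆X = [] , refl , U⊆X , refl
greedy-distinct {X} uniform {v} (z ∷ zs) U (z∈B ∷ zs⊆B) budget U⊆X
  with (a , b) , p∈ , fits ← fitting-pair uniform U z z∈B (≤-trans (budget-covers-step (length U) (length zs)) budget)
  with Y , |Y| , Y⊆X , ΣY ← greedy-distinct uniform zs (a ∷ b ∷ U) zs⊆B
                             (subst (_≤ v) (budget-after-step (length U) (length zs)) budget)
                             (SubMultiset-fits X U a b U⊆X fits)
  = a ∷ b ∷ Y
  , trans (cong (suc ∘ suc) |Y|) (sym (*-suc 2 (length zs)))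
  , SubMultiset-↭ X (shifts Y (a ∷ b ∷ [])) Y⊆X
  , trans (sym (+-assoc a b (sum Y))) (cong₂ _+_ (proj₂ (∈-sumPairs⁻ X z p∈)) ΣY)

lemma4p24 : (X : Multiset) → IsPosMultiset X → Uniform X → (v h : ℕ) → 1 ≤ v → 1 ≤ h → 4 * h + 1 ≤ v → (z : ℕ) → InSumset (InBucket v X) h z → SumOfDistinct X (2 * h) z
lemma4p24 X _ uniform v h _ _ budget z (zs , refl , zs⊆B , Σzs≡z)
  with Y , |Y| , Y⊆X , ΣY ← greedy-distinct uniform zs [] zs⊆B budget (λ _ → z≤n)
  = Y , |Y| , subst (λ W → SubMultiset W X) (++-identityʳ Y) Y⊆X , trans ΣY Σzs≡z
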